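{- For every $n\ge 0$, $R_n(1221)=w(\mathrm{LNN}_n)$; that is, the RGFs of length $n$ avoiding $1221$ are exactly the RGFs of the left nonnesting set partitions of $[n]$.
   Context: A restricted growth function (RGF) of length $n$ is a sequence $w=w_1\dots w_n$ of positive integers with $w_1=1$ and $w_i\le 1+\max\{w_1,\dots,w_{i-1}\}$ for $i\ge 2$; $R_n$ is the set of RGFs of length $n$. The standardization of a word replaces every occurrence of its smallest letter by $1$, of its next smallest letter by $2$, and so on. An RGF $w$ contains an RGF $v$ if some subword (subsequence, not necessarily consecutive) of $w$ standardizes to $v$; otherwise $w$ avoids $v$; $R_n(v)$ is the set of $w\in R_n$ avoiding $v$. A set partition $\sigma=B_1/\dots/B_k$ of $[n]$ is written in standard form $\min B_1<\dots<\min B_k$, and $w(\sigma)=w_1\dots w_n$ with $w_i=j$ iff $i\in B_j$; for a set $P$ of partitions $w(P)=\{w(\sigma):\sigma\in P\}$. The left arc diagram of $\sigma$ has, for each block $B$ and each $b\in B\setminus\{\min B\}$, an arc $(\min B,b)$. Two arcs $(a,b)$ and $(x,y)$ nest if $a<x<y<b$. $\sigma$ is left nonnesting if no two arcs of its left arc diagram nest; $\mathrm{LNN}_n$ is the set of left nonnesting partitions of $[n]$. -}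

module Defs where

open import Data.Nat using (ℕ; zero; suc; _≤_; _<_; _⊔_; _<?_; _≟_)
open import Data.Fin as Fin using (Fin; toℕ)
open import Data.Fin.Subset using (Subset; _∈_; Nonempty)
open import Data.List using (List; []; _∷_; map; filter; length; deduplicate)
open import Data.List.Relation.Binary.Sublist.Propositional using (_⊆_)
open import Data.Vec using (Vec; lookup; toList)
open import Data.Product using (Σ; ∃; _×_)
open import Data.Unit using (⊤)
open import Relation.Nullary using (¬_)
open import Relation.Binary.PropositionalEquality using (_≡_; _≢_)

RGFfrom : ℕ → List ℕ → Set
RGFfrom m []       = ⊤
RGFfrom m (x ∷ xs) = (1 ≤ x) × (x ≤ suc m) × RGFfrom (m ⊔ x) xs

-- w₁ = 1 (forced by 1 ≤ w₁ ≤ 1+0) and w_i ≤ 1 + max(w₁..w_{i-1}), all w_i ≥ 1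
IsRGF : List ℕ → Set
IsRGF = RGFfrom 0

std : List ℕ → List ℕ
std u = map (λ x → suc (length (deduplicate _≟_ (filter (_<? x) u)))) u

Contains : List ℕ → List ℕ → Set
Contains w v = ∃ λ u → (u ⊆ w) × (std u ≡ v)

Avoids : List ℕ → List ℕ → Set
Avoids w v = ¬ Contains w v

pat1221 : List ℕ
pat1221 = 1 ∷ 2 ∷ 2 ∷ 1 ∷ []

-- Set partitions of [n]  (element i ∈ [n] is represented by Fin n, i ↦ i+1)

IsMin : ∀ {n} → Fin n → Subset n → Set
IsMin {n} x B = (x ∈ B) × (∀ (y : Fin n) → y ∈ B → x Fin.≤ y)

record SetPartition (n : ℕ) : Set where
  field
    k        : ℕ
    block    : Fin k → Subset n
    nonempty : ∀ j → Nonempty (block j)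
    covers   : ∀ (i : Fin n) → ∃ λ j → i ∈ block j
    disjoint : ∀ (i : Fin n) (j j′ : Fin k) → i ∈ block j → i ∈ block j′ → j ≡ j′
    standard : ∀ (j j′ : Fin k) (x x′ : Fin n) → j Fin.< j′ →
               IsMin x (block j) → IsMin x′ (block j′) → x Fin.< x′

open SetPartition public

IsWordOf : ∀ {n} → SetPartition n → Vec ℕ n → Set
IsWordOf {n} σ w = ∀ (i : Fin n) (j : Fin (k σ)) → i ∈ block σ j → lookup w i ≡ suc (toℕ j)

IsLeftArc : ∀ {n} → SetPartition n → Fin n → Fin n → Set
IsLeftArc σ a b = ∃ λ j → IsMin a (block σ j) × (b ∈ block σ j) × (b ≢ a)

LeftNonnesting : ∀ {n} → SetPartition n → Set
LeftNonnesting {n} σ = ∀ (a b x y : Fin n) → IsLeftArc σ a b → IsLeftArc σ x y →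
  ¬ ((a Fin.< x) × (x Fin.< y) × (y Fin.< b))

module Submission where

-- A word is an RGF iff its letters are positive and every smaller positive
-- value occurs earlier; then the blocks B_j = {i ∣ w_i = j} form a partition
-- in standard form, whose blocks are ordered like their minima.  So nesting
-- arcs (min B_p, b), (min B_q, y) with min B_p < min B_q < y < b have p < q,
-- and w reads p q q p at these four positions: a copy of 1221.  Conversely a
-- copy p q q p (p < q) at positions i < j < k < l yields the arcs (min B_p, l)
-- and (min B_q, k), which nest because min B_p < min B_q ≤ j < k.

open import Defs
open import Data.Nat using (ℕ; zero; suc; _≤_; _<_; _⊔_; _<?_; _≟_; z≤n; s≤s)
open import Data.Nat.Properties
open import Data.Fin as Fin using (Fin; toℕ; fromℕ<)
open import Data.Fin.Properties as Finₚ using (toℕ-injective; toℕ-fromℕ<; toℕ<n)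
open import Data.Fin.Subset using (Subset; _∈_; inside; outside)
open import Data.List using (List; []; _∷_; filter; length; deduplicate)
open import Data.List.Membership.Propositional using () renaming (_∈_ to _∈ₗ_)
open import Data.List.Membership.Propositional.Properties using (∈-filter⁺; ∈-deduplicate⁺)
open import Data.List.Properties using (filter-none; filter-accept; filter-reject)
open import Data.List.Relation.Unary.All using ([]; _∷_)
open import Data.List.Relation.Unary.Any using (here; there)
open import Data.List.Relation.Binary.Sublist.Propositional using (_⊆_; []; _∷_; _∷ʳ_; minimum)
open import Data.Vec using (Vec; lookup; toList; tabulate; _[_]=_) renaming (_∷_ to _∷ᵥ_; [] to []ᵥ)
open import Data.Vec.Properties using (lookup⇒[]=; []=⇒lookup; lookup∘tabulate)
open import Data.Bool.Properties using (T-≡)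
open import Data.Product using (∃; ∃₂; _×_; _,_; proj₁; proj₂)
open import Data.Sum using (_⊎_; inj₁; inj₂)
open import Data.Unit using (⊤; tt)
open import Data.Empty using (⊥-elim)
open import Function using (_∘_)
open import Function.Bundles using (_⇔_; mk⇔; Equivalence)
open import Relation.Nullary using (¬?; Dec; yes; no)
open import Relation.Nullary.Decidable using (⌊_⌋; toWitness; fromWitness)
open import Relation.Binary.PropositionalEquality
open import Relation.Binary.Definitions using (tri<; tri≈; tri>)

-- std u is definitionally map (suc ∘ rank u) u.
rank : List ℕ → ℕ → ℕ
rank u x = length (deduplicate _≟_ (filter (_<? x) u))

∈⇒1≤length : ∀ {A : Set} {x : A} {xs} → x ∈ₗ xs → 1 ≤ length xs
∈⇒1≤length (here _)  = s≤s z≤n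
∈⇒1≤length (there _) = s≤s z≤n

distinct-∈⇒2≤length : ∀ {A : Set} {y z : A} {xs} → y ∈ₗ xs → z ∈ₗ xs → y ≢ z → 2 ≤ length xs
distinct-∈⇒2≤length (here refl) (here refl) y≢z = ⊥-elim (y≢z refl)
distinct-∈⇒2≤length (here _)    (there z∈)  _   = s≤s (∈⇒1≤length z∈)
distinct-∈⇒2≤length (there y∈)  _           _   = s≤s (∈⇒1≤length y∈)

∈-smaller : ∀ {u y x} → y ∈ₗ u → y < x → y ∈ₗ deduplicate _≟_ (filter (_<? x) u)
∈-smaller {x = x} y∈ y<x = ∈-deduplicate⁺ _≟_ (∈-filter⁺ (_<? x) y∈ y<x)

rank≡0⇒≤ : ∀ {u x y} → rank u x ≡ 0 → y ∈ₗ u → x ≤ y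
rank≡0⇒≤ r≡0 y∈ = ≮⇒≥ λ y<x → 1+n≰n (subst (1 ≤_) r≡0 (∈⇒1≤length (∈-smaller y∈ y<x)))

rank≡1⇒≡ : ∀ {u x y z} → rank u x ≡ 1 → y ∈ₗ u → z ∈ₗ u → y < x → z < x → y ≡ z
rank≡1⇒≡ {y = y} {z} r≡1 y∈ z∈ y<x z<x with y ≟ z
... | yes y≡z = y≡z
... | no  y≢z = ⊥-elim (1+n≰n (subst (2 ≤_) r≡1
                  (distinct-∈⇒2≤length (∈-smaller y∈ y<x) (∈-smaller z∈ z<x) y≢z)))

pat1221-ranks : ∀ {ra rb rc rd} → suc ra ∷ suc rb ∷ suc rc ∷ suc rd ∷ [] ≡ pat1221 →
                ra ≡ 0 × rb ≡ 1 × rc ≡ 1 × rd ≡ 0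
pat1221-ranks refl = refl , refl , refl , refl

std≡1221⇒ : ∀ u → std u ≡ pat1221 → ∃₂ λ P Q → P < Q × u ≡ P ∷ Q ∷ Q ∷ P ∷ []
std≡1221⇒ (a ∷ b ∷ c ∷ d ∷ []) std≡ with pat1221-ranks std≡
... | ra , rb , rc , rd = a , b , a<b , cong₂ (λ s t → a ∷ b ∷ s ∷ t ∷ []) (sym b≡c) (sym a≡d)
  where
  a∈ = here refl
  b∈ = there (here refl)
  c∈ = there (there (here refl))
  d∈ = there (there (there (here refl)))
  a≡d : a ≡ d
  a≡d = ≤-antisym (rank≡0⇒≤ ra d∈) (rank≡0⇒≤ rd a∈)
  a<b : a < b
  a<b = ≤∧≢⇒< (rank≡0⇒≤ ra b∈) λ { refl → 0≢1+n (trans (sym ra) rb) }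
  a<c : a < c
  a<c = ≤∧≢⇒< (rank≡0⇒≤ ra c∈) λ { refl → 0≢1+n (trans (sym ra) rc) }
  b≡c : b ≡ c
  b≡c = ≤-antisym (≮⇒≥ λ c<b → <⇒≢ a<c (rank≡1⇒≡ rb a∈ c∈ a<b c<b))
                  (≮⇒≥ λ b<c → <⇒≢ a<b (rank≡1⇒≡ rc a∈ b∈ a<c b<c))
std≡1221⇒ []                      ()
std≡1221⇒ (_ ∷ [])                ()
std≡1221⇒ (_ ∷ _ ∷ [])            ()
std≡1221⇒ (_ ∷ _ ∷ _ ∷ [])        ()
std≡1221⇒ (_ ∷ _ ∷ _ ∷ _ ∷ _ ∷ _) ()

std-1221 : ∀ {P Q} → P < Q → std (P ∷ Q ∷ Q ∷ P ∷ []) ≡ pat1221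
std-1221 {P} {Q} P<Q = cong₂ (λ r s → suc r ∷ suc s ∷ suc s ∷ suc r ∷ []) rank-P rank-Q
  where
  u = P ∷ Q ∷ Q ∷ P ∷ []
  rank-P : rank u P ≡ 0
  rank-P = cong (length ∘ deduplicate _≟_)
    (filter-none (_<? P) (n≮n P ∷ <-asym P<Q ∷ <-asym P<Q ∷ n≮n P ∷ []))
  rank-Q : rank u Q ≡ 1
  rank-Q rewrite filter-accept (_<? Q) {P} {Q ∷ Q ∷ P ∷ []} P<Q
               | filter-reject (_<? Q) {Q} {Q ∷ P ∷ []} (n≮n Q)
               | filter-reject (_<? Q) {Q} {P ∷ []} (n≮n Q)
               | filter-accept (_<? Q) {P} {[]} P<Q
               | filter-reject (λ y → ¬? (P ≟ y)) {P} {[]} (λ P≢P → P≢P refl)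
               = refl

OccursFrom : ∀ {n} → List ℕ → Vec ℕ n → ℕ → Set
OccursFrom         []      w b = ⊤
OccursFrom {n} (x ∷ u) w b =
  ∃ λ (i : Fin n) → b ≤ toℕ i × lookup w i ≡ x × OccursFrom u w (suc (toℕ i))

OccursFrom-∷⁺ : ∀ {n} u {w : Vec ℕ n} {y b} → OccursFrom u w b → OccursFrom u (y ∷ᵥ w) (suc b)
OccursFrom-∷⁺ []      _                     = tt
OccursFrom-∷⁺ (x ∷ u) (i , b≤i , wᵢ≡x , occ) = Fin.suc i , s≤s b≤i , wᵢ≡x , OccursFrom-∷⁺ u occ

OccursFrom-∷⁻ : ∀ {n} u {w : Vec ℕ n} {y b} → OccursFrom u (y ∷ᵥ w) (suc b) → OccursFrom u w b
OccursFrom-∷⁻ []      _                                  = tt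
OccursFrom-∷⁻ (x ∷ u) (Fin.suc i , s≤s b≤i , wᵢ≡x , occ) = i , b≤i , wᵢ≡x , OccursFrom-∷⁻ u occ

OccursFrom-anti : ∀ {n} u {w : Vec ℕ n} {b b′} → b′ ≤ b → OccursFrom u w b → OccursFrom u w b′
OccursFrom-anti []      _    _                     = tt
OccursFrom-anti (x ∷ u) b′≤b (i , b≤i , wᵢ≡x , occ) = i , ≤-trans b′≤b b≤i , wᵢ≡x , occ

⊆⇒OccursFrom : ∀ {n} (w : Vec ℕ n) u → u ⊆ toList w → OccursFrom u w 0
⊆⇒OccursFrom []ᵥ       []      []          = tt
⊆⇒OccursFrom (y ∷ᵥ w) u       (.y ∷ʳ u⊆w) =
  OccursFrom-anti u z≤n (OccursFrom-∷⁺ u (⊆⇒OccursFrom w u u⊆w))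
⊆⇒OccursFrom (y ∷ᵥ w) (x ∷ u) (refl ∷ u⊆w) =
  Fin.zero , z≤n , refl , OccursFrom-∷⁺ u (⊆⇒OccursFrom w u u⊆w)

OccursFrom⇒⊆ : ∀ {n} (w : Vec ℕ n) u → OccursFrom u w 0 → u ⊆ toList w
OccursFrom⇒⊆ w        []      _ = minimum (toList w)
OccursFrom⇒⊆ (y ∷ᵥ w) (x ∷ u) (Fin.zero , _ , refl , occ) =
  refl ∷ OccursFrom⇒⊆ w u (OccursFrom-∷⁻ u occ)
OccursFrom⇒⊆ (y ∷ᵥ w) (x ∷ u) (Fin.suc i , _ , wᵢ≡x , occ) =
  y ∷ʳ OccursFrom⇒⊆ w (x ∷ u) (i , z≤n , wᵢ≡x , OccursFrom-∷⁻ u occ)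

record Occurrence1221 {n} (w : Vec ℕ n) : Set where
  field
    i₁ i₂ i₃ i₄ : Fin n
    i₁<i₂       : i₁ Fin.< i₂
    i₂<i₃       : i₂ Fin.< i₃
    i₃<i₄       : i₃ Fin.< i₄
    outer       : lookup w i₄ ≡ lookup w i₁
    inner       : lookup w i₃ ≡ lookup w i₂
    outer<inner : lookup w i₁ < lookup w i₂

contains1221⇒occurrence : ∀ {n} (w : Vec ℕ n) → Contains (toList w) pat1221 → Occurrence1221 w
contains1221⇒occurrence w (u , u⊆w , std≡) with std≡1221⇒ u std≡
... | P , Q , P<Q , refl with ⊆⇒OccursFrom w u u⊆w
... | i , _ , wᵢ≡P , j , i<j , wⱼ≡Q , k , j<k , wₖ≡Q , l , k<l , wₗ≡P , _ = record
  { i₁<i₂ = i<j ; i₂<i₃ = j<k ; i₃<i₄ = k<l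
  ; outer = trans wₗ≡P (sym wᵢ≡P)
  ; inner = trans wₖ≡Q (sym wⱼ≡Q)
  ; outer<inner = subst₂ _<_ (sym wᵢ≡P) (sym wⱼ≡Q) P<Q
  }

occurrence⇒contains1221 : ∀ {n} (w : Vec ℕ n) → Occurrence1221 w → Contains (toList w) pat1221
occurrence⇒contains1221 w o = u , OccursFrom⇒⊆ w u occ , std-1221 outer<inner
  where
  open Occurrence1221 o
  u = lookup w i₁ ∷ lookup w i₂ ∷ lookup w i₂ ∷ lookup w i₁ ∷ []
  occ : OccursFrom u w 0
  occ = i₁ , z≤n , refl , i₂ , i₁<i₂ , refl , i₃ , i₂<i₃ , inner , i₄ , i₃<i₄ , outer , tt

-- m is the running maximum of RGFfrom m; for m = 0 this characterises RGFs.
GrowsFrom : ℕ → ∀ {n} → Vec ℕ n → Set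
GrowsFrom m {n} w = ∀ (i : Fin n) → 1 ≤ lookup w i ×
  (∀ v → v < lookup w i → v ≤ m ⊎ ∃ λ (i′ : Fin n) → i′ Fin.< i × lookup w i′ ≡ v)

≤⊔⇒≤⊎≡ : ∀ {v m x} → x ≤ suc m → v ≤ m ⊔ x → v ≤ m ⊎ v ≡ x
≤⊔⇒≤⊎≡ {v} {m} {x} x≤1+m v≤m⊔x with ⊔-sel m x
... | inj₁ m⊔x≡m = inj₁ (subst (v ≤_) m⊔x≡m v≤m⊔x)
... | inj₂ m⊔x≡x with m≤n⇒m<n∨m≡n (subst (v ≤_) m⊔x≡x v≤m⊔x)
...   | inj₁ v<x = inj₁ (≤-pred (≤-trans v<x x≤1+m))
...   | inj₂ v≡x = inj₂ v≡x

GrowsFrom-∷ : ∀ {m n x} {xs : Vec ℕ n} →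
              1 ≤ x → x ≤ suc m → GrowsFrom (m ⊔ x) xs → GrowsFrom m (x ∷ᵥ xs)
GrowsFrom-∷ 1≤x x≤1+m g Fin.zero    = 1≤x , λ v v<x → inj₁ (≤-pred (≤-trans v<x x≤1+m))
GrowsFrom-∷ {m} {n} {x} {xs} 1≤x x≤1+m g (Fin.suc i) =
  proj₁ (g i) , λ v v<xsᵢ → shift (proj₂ (g i) v v<xsᵢ)
  where
  shift : ∀ {v} → v ≤ m ⊔ x ⊎ (∃ λ i′ → i′ Fin.< i × lookup xs i′ ≡ v) →
          v ≤ m ⊎ ∃ λ i′ → i′ Fin.< Fin.suc i × lookup (x ∷ᵥ xs) i′ ≡ v
  shift (inj₂ (i′ , i′<i , xsᵢ′≡v)) = inj₂ (Fin.suc i′ , s≤s i′<i , xsᵢ′≡v)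
  shift (inj₁ v≤m⊔x) with ≤⊔⇒≤⊎≡ x≤1+m v≤m⊔x
  ... | inj₁ v≤m  = inj₁ v≤m
  ... | inj₂ refl = inj₂ (Fin.zero , s≤s z≤n , refl)

GrowsFrom-head : ∀ {m n x} {xs : Vec ℕ n} → GrowsFrom m (x ∷ᵥ xs) → 1 ≤ x × x ≤ suc m
GrowsFrom-head {x = suc y} g with proj₂ (g Fin.zero) y ≤-refl
... | inj₁ y≤m = s≤s z≤n , s≤s y≤m
... | inj₂ (_ , () , _)
GrowsFrom-head {x = zero} g with proj₁ (g Fin.zero)
... | ()

GrowsFrom-tail : ∀ {m n x} {xs : Vec ℕ n} → GrowsFrom m (x ∷ᵥ xs) → GrowsFrom (m ⊔ x) xs
GrowsFrom-tail {m} {n} {x} {xs} g i =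
  proj₁ (g (Fin.suc i)) , λ v v<xsᵢ → unshift (proj₂ (g (Fin.suc i)) v v<xsᵢ)
  where
  unshift : ∀ {v} → v ≤ m ⊎ (∃ λ i′ → i′ Fin.< Fin.suc i × lookup (x ∷ᵥ xs) i′ ≡ v) →
            v ≤ m ⊔ x ⊎ ∃ λ i′ → i′ Fin.< i × lookup xs i′ ≡ v
  unshift (inj₁ v≤m)                               = inj₁ (≤-trans v≤m (m≤m⊔n m x))
  unshift (inj₂ (Fin.zero , _ , refl))             = inj₁ (m≤n⊔m m x)
  unshift (inj₂ (Fin.suc i′ , s≤s i′<i , xsᵢ′≡v)) = inj₂ (i′ , i′<i , xsᵢ′≡v)

RGFfrom⇒GrowsFrom : ∀ m {n} (w : Vec ℕ n) → RGFfrom m (toList w) → GrowsFrom m w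
RGFfrom⇒GrowsFrom m (x ∷ᵥ xs) (1≤x , x≤1+m , rgf) =
  GrowsFrom-∷ 1≤x x≤1+m (RGFfrom⇒GrowsFrom (m ⊔ x) xs rgf)

GrowsFrom⇒RGFfrom : ∀ m {n} (w : Vec ℕ n) → GrowsFrom m w → RGFfrom m (toList w)
GrowsFrom⇒RGFfrom m []ᵥ       _ = tt
GrowsFrom⇒RGFfrom m (x ∷ᵥ xs) g =
  proj₁ (GrowsFrom-head g) , proj₂ (GrowsFrom-head g) , GrowsFrom⇒RGFfrom (m ⊔ x) xs (GrowsFrom-tail g)

earlier-value : ∀ {n} (w : Vec ℕ n) → GrowsFrom 0 w →
                ∀ i {v} → suc v < lookup w i → ∃ λ i′ → i′ Fin.< i × lookup w i′ ≡ suc v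
earlier-value w g i {v} 1+v<wᵢ with proj₂ (g i) (suc v) 1+v<wᵢ
... | inj₁ ()
... | inj₂ earlier = earlier

maximum : ∀ {n} → Vec ℕ n → ℕ
maximum []ᵥ       = 0
maximum (x ∷ᵥ xs) = x ⊔ maximum xs

lookup≤maximum : ∀ {n} (w : Vec ℕ n) i → lookup w i ≤ maximum w
lookup≤maximum (x ∷ᵥ xs) Fin.zero    = m≤m⊔n x (maximum xs)
lookup≤maximum (x ∷ᵥ xs) (Fin.suc i) = ≤-trans (lookup≤maximum xs i) (m≤n⊔m x (maximum xs))

<maximum⇒<lookup : ∀ {n} (w : Vec ℕ n) {v} → v < maximum w → ∃ λ i → v < lookup w i
<maximum⇒<lookup (x ∷ᵥ xs) {v} v<max with ⊔-sel x (maximum xs)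
... | inj₁ max≡x = Fin.zero , subst (v <_) max≡x v<max
... | inj₂ max≡maxs with <maximum⇒<lookup xs (subst (v <_) max≡maxs v<max)
...   | i , v<xsᵢ = Fin.suc i , v<xsᵢ

∈-tabulate⇔ : ∀ {n} {P : Fin n → Set} (P? : ∀ i → Dec (P i)) {i} →
              i ∈ tabulate (λ i → ⌊ P? i ⌋) ⇔ P i
∈-tabulate⇔ P? {i} = mk⇔
  (λ i∈ → toWitness (Equivalence.from T-≡ (trans (sym (lookup∘tabulate _ i)) ([]=⇒lookup i∈))))
  (λ Pᵢ → lookup⇒[]= i _ (trans (lookup∘tabulate _ i) (Equivalence.to T-≡ (fromWitness Pᵢ))))

∃-minimum : ∀ {n} (p : Subset n) {x} → x ∈ p → ∃ λ m → IsMin m p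
∃-minimum (inside  ∷ᵥ p) _ = Fin.zero , _[_]=_.here , λ _ _ → z≤n
∃-minimum (outside ∷ᵥ p) (_[_]=_.there x∈) with ∃-minimum p x∈
... | m , m∈ , m-min =
  Fin.suc m , _[_]=_.there m∈ , λ { (Fin.suc y) (_[_]=_.there y∈) → s≤s (m-min y y∈) }

blockMin : ∀ {n} (σ : SetPartition n) → Fin (k σ) → Fin n
blockMin σ j = proj₁ (∃-minimum (block σ j) (proj₂ (nonempty σ j)))

blockMin-isMin : ∀ {n} (σ : SetPartition n) j → IsMin (blockMin σ j) (block σ j)
blockMin-isMin σ j = proj₂ (∃-minimum (block σ j) (proj₂ (nonempty σ j)))

blockMin<∈ : ∀ {n} (σ : SetPartition n) {j′ j i} → j′ Fin.< j → i ∈ block σ j → blockMin σ j′ Fin.< i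
blockMin<∈ σ {j′} {j} {i} j′<j i∈ =
  <-≤-trans (standard σ j′ j _ _ j′<j (blockMin-isMin σ j′) (blockMin-isMin σ j))
            (proj₂ (blockMin-isMin σ j) i i∈)

blockMin-arc : ∀ {n} (σ : SetPartition n) {j i} →
               i ∈ block σ j → blockMin σ j Fin.< i → IsLeftArc σ (blockMin σ j) i
blockMin-arc σ {j} i∈ min<i = j , blockMin-isMin σ j , i∈ , λ i≡min → Finₚ.<⇒≢ min<i (sym i≡min)

min<min⇒index< : ∀ {n} (σ : SetPartition n) {p q a x} →
                 IsMin a (block σ p) → IsMin x (block σ q) → a Fin.< x → p Fin.< q
min<min⇒index< σ {p} {q} {a} {x} (a∈ , a-min) (x∈ , x-min) a<x with Finₚ.<-cmp p q
... | tri< p<q _ _ = p<q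
... | tri≈ _ refl _ = ⊥-elim (<⇒≱ a<x (x-min a a∈))
... | tri> _ _ q<p = ⊥-elim (<-asym a<x (standard σ q p x a q<p (x∈ , x-min) (a∈ , a-min)))

module PartitionOfRGF {n} (w : Vec ℕ n) (g : GrowsFrom 0 w) where

  blocks : Fin (maximum w) → Subset n
  blocks j = tabulate (λ i → ⌊ lookup w i ≟ suc (toℕ j) ⌋)

  ∈-blocks⇔ : ∀ {i j} → i ∈ blocks j ⇔ lookup w i ≡ suc (toℕ j)
  ∈-blocks⇔ {j = j} = ∈-tabulate⇔ (λ i → lookup w i ≟ suc (toℕ j))

  ∈-blocks⁺ : ∀ {i j} → lookup w i ≡ suc (toℕ j) → i ∈ blocks j
  ∈-blocks⁺ = Equivalence.from ∈-blocks⇔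

  ∈-blocks⁻ : ∀ {i j} → i ∈ blocks j → lookup w i ≡ suc (toℕ j)
  ∈-blocks⁻ = Equivalence.to ∈-blocks⇔

  blocks-nonempty : ∀ j → ∃ λ i → i ∈ blocks j
  blocks-nonempty j with <maximum⇒<lookup w (toℕ<n j)
  ... | i , j<wᵢ with m≤n⇒m<n∨m≡n j<wᵢ
  ...   | inj₂ 1+j≡wᵢ = i , ∈-blocks⁺ (sym 1+j≡wᵢ)
  ...   | inj₁ 1+j<wᵢ = proj₁ earlier , ∈-blocks⁺ (proj₂ (proj₂ earlier))
    where earlier = earlier-value w g i 1+j<wᵢ

  blocks-cover : ∀ i → ∃ λ j → i ∈ blocks j
  blocks-cover i with lookup w i in wᵢ≡1+v | proj₁ (g i) | lookup≤maximum w i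
  ... | suc v | _ | 1+v≤max =
    fromℕ< 1+v≤max , ∈-blocks⁺ (trans wᵢ≡1+v (cong suc (sym (toℕ-fromℕ< 1+v≤max))))

  blocks-standard : ∀ j j′ x x′ → j Fin.< j′ → IsMin x (blocks j) → IsMin x′ (blocks j′) → x Fin.< x′
  blocks-standard j j′ x x′ j<j′ (_ , x-min) (x′∈ , _)
    with earlier-value w g x′ (subst (suc (toℕ j) <_) (sym (∈-blocks⁻ x′∈)) (s≤s j<j′))
  ... | i′ , i′<x′ , wᵢ′≡1+j = ≤-<-trans (x-min i′ (∈-blocks⁺ wᵢ′≡1+j)) i′<x′

  partition : SetPartition n
  partition = record
    { k        = maximum w
    ; block    = blocks
    ; nonempty = blocks-nonempty
    ; covers   = blocks-cover
    ; disjoint = λ i j j′ i∈ i∈′ →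
        toℕ-injective (suc-injective (trans (sym (∈-blocks⁻ i∈)) (∈-blocks⁻ i∈′)))
    ; standard = blocks-standard
    }

  isWordOf : IsWordOf partition w
  isWordOf i j = ∈-blocks⁻

  leftNonnesting : Avoids (toList w) pat1221 → LeftNonnesting partition
  leftNonnesting avoids a b x y (p , a-min , b∈ , _) (q , x-min , y∈ , _) (a<x , x<y , y<b) =
    avoids (occurrence⇒contains1221 w record
      { i₁<i₂ = a<x ; i₂<i₃ = x<y ; i₃<i₄ = y<b
      ; outer = trans (∈-blocks⁻ b∈) (sym (∈-blocks⁻ (proj₁ a-min)))
      ; inner = trans (∈-blocks⁻ y∈) (sym (∈-blocks⁻ (proj₁ x-min)))
      ; outer<inner = subst₂ _<_ (sym (∈-blocks⁻ (proj₁ a-min))) (sym (∈-blocks⁻ (proj₁ x-min)))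
                        (s≤s (min<min⇒index< partition a-min x-min a<x))
      })

module WordOfPartition {n} (σ : SetPartition n) (w : Vec ℕ n) (isWord : IsWordOf σ w) where

  blockOf : Fin n → Fin (k σ)
  blockOf i = proj₁ (covers σ i)

  ∈-blockOf : ∀ i → i ∈ block σ (blockOf i)
  ∈-blockOf i = proj₂ (covers σ i)

  lookup≡blockOf : ∀ i → lookup w i ≡ suc (toℕ (blockOf i))
  lookup≡blockOf i = isWord i (blockOf i) (∈-blockOf i)

  ∈-block⁺ : ∀ {i j} → lookup w i ≡ suc (toℕ j) → i ∈ block σ j
  ∈-block⁺ {i} wᵢ≡1+j = subst (λ j → i ∈ block σ j)
    (toℕ-injective (suc-injective (trans (sym (lookup≡blockOf i)) wᵢ≡1+j))) (∈-blockOf i)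

  growsFrom0 : GrowsFrom 0 w
  growsFrom0 i = subst (1 ≤_) (sym (lookup≡blockOf i)) (s≤s z≤n) , earlier
    where
    earlier : ∀ v → v < lookup w i → v ≤ 0 ⊎ ∃ λ i′ → i′ Fin.< i × lookup w i′ ≡ v
    earlier zero    _      = inj₁ z≤n
    earlier (suc v) 1+v<wᵢ =
      inj₂ (blockMin σ j′ , blockMin<∈ σ j′<j (∈-blockOf i) , wₘ≡1+v)
      where
      v<j : v < toℕ (blockOf i)
      v<j = ≤-pred (subst (suc v <_) (lookup≡blockOf i) 1+v<wᵢ)
      v<k = <-trans v<j (toℕ<n (blockOf i))
      j′ = fromℕ< v<k
      j′<j : j′ Fin.< blockOf i
      j′<j = subst (_< toℕ (blockOf i)) (sym (toℕ-fromℕ< v<k)) v<j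
      wₘ≡1+v : lookup w (blockMin σ j′) ≡ suc v
      wₘ≡1+v = trans (isWord _ j′ (proj₁ (blockMin-isMin σ j′))) (cong suc (toℕ-fromℕ< v<k))

  avoids1221 : LeftNonnesting σ → Avoids (toList w) pat1221
  avoids1221 nonnesting contains =
    nonnesting (blockMin σ p) i₄ (blockMin σ q) i₃
      (blockMin-arc σ (∈-block⁺ (trans outer (lookup≡blockOf i₁))) mP<i₄)
      (blockMin-arc σ (∈-block⁺ (trans inner (lookup≡blockOf i₂))) mQ<i₃)
      (mP<mQ , mQ<i₃ , i₃<i₄)
    where
    open Occurrence1221 (contains1221⇒occurrence w contains)
    p = blockOf i₁
    q = blockOf i₂
    p<q : p Fin.< q
    p<q = ≤-pred (subst₂ _<_ (lookup≡blockOf i₁) (lookup≡blockOf i₂) outer<inner)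
    mP<mQ = standard σ p q _ _ p<q (blockMin-isMin σ p) (blockMin-isMin σ q)
    mQ<i₃ = ≤-<-trans (proj₂ (blockMin-isMin σ q) i₂ (∈-blockOf i₂)) i₂<i₃
    mP<i₄ = <-trans mP<mQ (<-trans mQ<i₃ i₃<i₄)

proposition6p2 : ∀ (n : ℕ) (w : Vec ℕ n) →
    (IsRGF (toList w) × Avoids (toList w) pat1221)
      ⇔ (∃ λ (σ : SetPartition n) → LeftNonnesting σ × IsWordOf σ w)
proposition6p2 n w = mk⇔
  (λ (rgf , avoids) → let open PartitionOfRGF w (RGFfrom⇒GrowsFrom 0 w rgf)
                       in partition , leftNonnesting avoids , isWordOf)
  (λ (σ , nonnesting , isWord) → let open WordOfPartition σ w isWord
                                  in GrowsFrom⇒RGFfrom 0 w growsFrom0 , avoids1221 nonnesting)
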